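{- Let $s=f_1^{e_1}\cdots f_m^{e_m}$ be the Lyndon factorization of a string $s$, with Lyndon runs $F_i=f_i^{e_i}$ (viewed as consecutive substrings of $s$). Let $d\ge1$ and $1\le i\le m-d+1$, and assume that the string $F_iF_{i+1}\cdots F_{i+d-1}$ has an occurrence in $s$ starting to the left of its trivial occurrence (the one formed by the runs $F_i,\dots,F_{i+d-1}$ themselves). Then: (1) the leftmost occurrence of $F_iF_{i+1}\cdots F_{i+d-1}$ in $s$ is a prefix of (the first copy of) $f_j$ inside the run $F_j$, for some $j<i$; (2) for this $j$, the string $F_iF_{i+1}\cdots F_{i+d-1}$ is a prefix of $f_k$ for every $k$ with $j<k<i$.
   Context: Lexicographic order: $u\preceq v$ if either $u$ is a prefix of $v$, or $u=xaw_1$, $v=xbw_2$ with letters $a\prec b$. A Lyndon word is a nonempty string strictly lexicographically smaller than each of its nonempty proper suffixes. The Lyndon factorization of $s$ is the unique factorization $s=f_1^{e_1}\cdots f_m^{e_m}$ with each $f_i$ a Lyndon word, $e_i\ge1$, and $f_i\succ f_{i+1}$ for $1\le i<m$; $F_i=f_i^{e_i}$ are the Lyndon runs. -}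

module Defs where

open import Level using (0ℓ)
open import Data.Nat using (ℕ; zero; suc; _≤_; _<_; _+_)
open import Data.List using (List; []; _∷_; _++_; concat; replicate; map; take; drop; length)
open import Data.Product using (Σ; ∃; _×_; _,_; proj₁; proj₂)
open import Data.Sum using (_⊎_)
open import Data.Unit using (⊤)
open import Relation.Binary.PropositionalEquality using (_≡_; _≢_)
open import Relation.Binary.Core using (Rel)

-- Strings over an alphabet A ordered by a strict order _<ₐ_
-- (assumed a strict total order w.r.t. ≡ in the statement).
module Lyndon {A : Set} (_<ₐ_ : Rel A 0ℓ) where

  Word : Set
  Word = List A

  _⪯_ : Word → Word → Set
  u ⪯ v = (∃ λ w → v ≡ u ++ w)
        ⊎ (∃ λ x → ∃ λ a → ∃ λ b → ∃ λ w₁ → ∃ λ w₂ →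
             (a <ₐ b) × (u ≡ x ++ (a ∷ w₁)) × (v ≡ x ++ (b ∷ w₂)))

  _≺_ : Word → Word → Set
  u ≺ v = (u ⪯ v) × (u ≢ v)

  IsLyndon : Word → Set
  IsLyndon w = (w ≢ []) × (∀ p t → w ≡ p ++ t → p ≢ [] → t ≢ [] → w ≺ t)

  _^_ : Word → ℕ → Word
  f ^ e = concat (replicate e f)

  data Decreasing : List Word → Set where
    dec-[] : Decreasing []
    dec-[_] : ∀ x → Decreasing (x ∷ [])
    dec-∷ : ∀ {x y l} → y ≺ x → Decreasing (y ∷ l) → Decreasing (x ∷ y ∷ l)

  -- A factorization is a list of pairs (f_i , e_i); indices are 0-based.
  Run : Word × ℕ → Word
  Run (f , e) = f ^ e

  AllLyndonPos : List (Word × ℕ) → Set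
  AllLyndonPos [] = ⊤
  AllLyndonPos (fe ∷ fs) = IsLyndon (proj₁ fe) × (1 ≤ proj₂ fe) × AllLyndonPos fs

  IsLyndonFactorization : Word → List (Word × ℕ) → Set
  IsLyndonFactorization s fs =
    (concat (map Run fs) ≡ s) × AllLyndonPos fs × Decreasing (map proj₁ fs)

  -- the word f_k (0-based; default [] out of range, only used in range)
  fAt : List (Word × ℕ) → ℕ → Word
  fAt [] _ = []
  fAt (fe ∷ _) zero = proj₁ fe
  fAt (_ ∷ fs) (suc k) = fAt fs k

  runStart : List (Word × ℕ) → ℕ → ℕ
  runStart fs k = length (concat (map Run (take k fs)))

  block : List (Word × ℕ) → ℕ → ℕ → Word
  block fs i d = concat (map Run (take d (drop i fs)))

  OccursAt : Word → Word → ℕ → Set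
  OccursAt u s p = ∃ λ x → ∃ λ y → (s ≡ x ++ u ++ y) × (length x ≡ p)

  IsPrefix : Word → Word → Set
  IsPrefix u v = ∃ λ w → v ≡ u ++ w

-- Let w = F_i ⋯ F_{i+d-1} and Z = F_i F_{i+1} ⋯ F_m, so that w is a prefix of Z. Since the
-- factors are Lyndon and strictly decreasing, Z < f_k for every k < i. An occurrence of w starting
-- before F_i starts inside a copy of some f_j (j < i), at a nonempty suffix u of f_j, and u ≥ f_j
-- because f_j is Lyndon. Both w and u are prefixes of the text at that position, so
-- w ⊑ Z < f_j ≤ u forces w to be a prefix of f_j. The least such j gives the leftmost occurrence,
-- and for j < k < i the same squeeze, now with Z < f_k < f_j ⊒ w, makes w a prefix of f_k.
module Submission where

open import Level using (0ℓ)
open import Data.Empty using (⊥-elim)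
open import Data.Nat using (ℕ; zero; suc; _≤_; _<_; _+_; z≤n; s≤s; _<?_)
open import Data.Nat.Properties
  using (≤-trans; <-≤-trans; ≤-<-trans; +-monoʳ-≤; +-cancelˡ-<; ≮⇒≥; <⇒≤; m≤m+n; anyUpTo?)
open import Data.Nat.Induction using (<-rec)
open import Data.List using (List; []; _∷_; _++_; concat; map; take; drop; length)
open import Data.List.Properties
  using (++-assoc; ++-identityʳ; length-++; concat-++; map-++; take++drop≡id; ∷-injective)
open import Data.List.Relation.Binary.Pointwise using (Pointwise-≡⇒≡; ≡⇒Pointwise-≡)
open import Data.List.Relation.Binary.Prefix.Heterogeneous as Prefix
  using (Prefix; []; _∷_; toView; _++ᵖ_)
open import Data.List.Relation.Binary.Prefix.Heterogeneous.Properties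
  using (prefix?; ++⁺; ++⁻; fromPointwise)
  renaming (trans to Prefix-trans; antisym to Prefix-antisym)
open import Data.Product using (∃; _×_; _,_; proj₁; proj₂)
open import Data.Sum using (_⊎_; inj₁; inj₂)
open import Data.Unit using (⊤; tt)
open import Function using (_∘′_)
open import Relation.Nullary using (¬_; Dec; yes; no)
open import Relation.Binary.PropositionalEquality
  using (_≡_; _≢_; refl; sym; trans; cong; subst; subst₂; module ≡-Reasoning)
open import Relation.Binary.Core using (Rel)
open import Relation.Binary.Structures using (IsStrictTotalOrder)
open import Defs

least-witness : {P : ℕ → Set} → (∀ n → Dec (P n)) → ∀ {n} → P n →
                ∃ λ m → P m × (∀ {k} → k < m → ¬ P k)
least-witness {P} P? {n} = <-rec (λ n → P n → Least) step n
  where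
  Least : Set
  Least = ∃ λ m → P m × (∀ {k} → k < m → ¬ P k)

  step : ∀ n → (∀ {m} → m < n → P m → Least) → P n → Least
  step n rec Pn with anyUpTo? P? n
  ... | yes (m , m<n , Pm) = rec m<n Pm
  ... | no none            = n , Pn , λ k<n Pk → none (_ , k<n , Pk)

module WordOrder {A : Set} (_<ₐ_ : Rel A 0ℓ) (sto : IsStrictTotalOrder _≡_ _<ₐ_) where

  open IsStrictTotalOrder sto using (_≟_)
    renaming (trans to <ₐ-trans; irrefl to <ₐ-irrefl; asym to <ₐ-asym)
  open Lyndon _<ₐ_

  infix 4 _⊑_ _◁_ _≤ˡ_ _<ˡ_

  _⊑_ : Word → Word → Set
  _⊑_ = Prefix _≡_

  ⊑-refl : ∀ {u} → u ⊑ u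
  ⊑-refl = fromPointwise (≡⇒Pointwise-≡ refl)

  ⊑-++ : ∀ u v → u ⊑ u ++ v
  ⊑-++ u v = ⊑-refl ++ᵖ v

  ⊑-trans : ∀ {u v w} → u ⊑ v → v ⊑ w → u ⊑ w
  ⊑-trans = Prefix-trans trans

  ⊑-antisym : ∀ {u v} → u ⊑ v → v ⊑ u → u ≡ v
  ⊑-antisym p q = Pointwise-≡⇒≡ (Prefix-antisym (λ a≡b _ → a≡b) p q)

  ⊑-++⁺ : ∀ x {u v} → u ⊑ v → x ++ u ⊑ x ++ v
  ⊑-++⁺ x = ++⁺ (≡⇒Pointwise-≡ refl)

  ⊑-++⁻ : ∀ x {u v} → x ++ u ⊑ x ++ v → u ⊑ v
  ⊑-++⁻ x = ++⁻ {as = x} refl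

  _⊑?_ : ∀ u v → Dec (u ⊑ v)
  _⊑?_ = prefix? _≟_

  ⊑⇒IsPrefix : ∀ {u v} → u ⊑ v → IsPrefix u v
  ⊑⇒IsPrefix p with toView p
  ... | u≋v Prefix.++ w = w , cong (_++ w) (sym (Pointwise-≡⇒≡ u≋v))

  IsPrefix⇒⊑ : ∀ {u v} → IsPrefix u v → u ⊑ v
  IsPrefix⇒⊑ {u} (w , refl) = ⊑-++ u w

  ⊑-comparable : ∀ {u v t} → u ⊑ t → v ⊑ t → u ⊑ v ⊎ v ⊑ u
  ⊑-comparable [] _ = inj₁ []
  ⊑-comparable (_ ∷ _) [] = inj₂ []
  ⊑-comparable (refl ∷ p) (refl ∷ q) with ⊑-comparable p q
  ... | inj₁ u⊑v = inj₁ (refl ∷ u⊑v)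
  ... | inj₂ v⊑u = inj₂ (refl ∷ v⊑u)

  data _◁_ : Word → Word → Set where
    here  : ∀ {a b u v} → a <ₐ b → a ∷ u ◁ b ∷ v
    there : ∀ {c u v} → u ◁ v → c ∷ u ◁ c ∷ v

  ◁-++⁺ : ∀ x {u v} → u ◁ v → x ++ u ◁ x ++ v
  ◁-++⁺ []      u◁v = u◁v
  ◁-++⁺ (c ∷ x) u◁v = there (◁-++⁺ x u◁v)

  ◁-⊑ʳ : ∀ {u v v′} → u ◁ v → v ⊑ v′ → u ◁ v′
  ◁-⊑ʳ (here a<b)  (refl ∷ _) = here a<b
  ◁-⊑ʳ (there u◁v) (refl ∷ p) = there (◁-⊑ʳ u◁v p)

  ◁-⊑ˡ : ∀ {u u′ v} → u ◁ v → u ⊑ u′ → u′ ◁ v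
  ◁-⊑ˡ (here a<b)  (refl ∷ _) = here a<b
  ◁-⊑ˡ (there u◁v) (refl ∷ p) = there (◁-⊑ˡ u◁v p)

  ◁-trans : ∀ {u v w} → u ◁ v → v ◁ w → u ◁ w
  ◁-trans (here a<b)  (here b<c)  = here (<ₐ-trans a<b b<c)
  ◁-trans (here a<b)  (there _)   = here a<b
  ◁-trans (there _)   (here b<c)  = here b<c
  ◁-trans (there u◁v) (there v◁w) = there (◁-trans u◁v v◁w)

  ◁-asym : ∀ {u v} → u ◁ v → ¬ v ◁ u
  ◁-asym (here a<b)  (here b<a)   = <ₐ-asym a<b b<a
  ◁-asym (here a<b)  (there _)    = <ₐ-irrefl refl a<b
  ◁-asym (there _)   (here b<a)   = <ₐ-irrefl refl b<a
  ◁-asym (there u◁v) (there v◁u) = ◁-asym u◁v v◁u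

  ◁⇒⋢ : ∀ {u v} → u ◁ v → ¬ u ⊑ v
  ◁⇒⋢ (here a<b)  (refl ∷ _) = <ₐ-irrefl refl a<b
  ◁⇒⋢ (there u◁v) (refl ∷ p) = ◁⇒⋢ u◁v p

  ◁⇒⋣ : ∀ {u v} → u ◁ v → ¬ v ⊑ u
  ◁⇒⋣ (here a<b)  (refl ∷ _) = <ₐ-irrefl refl a<b
  ◁⇒⋣ (there u◁v) (refl ∷ p) = ◁⇒⋣ u◁v p

  ⊑-◁ : ∀ {u v w} → u ⊑ v → v ◁ w → u ⊑ w ⊎ u ◁ w
  ⊑-◁ []         _           = inj₁ []
  ⊑-◁ (refl ∷ _) (here a<b)  = inj₂ (here a<b)
  ⊑-◁ (refl ∷ p) (there v◁w) with ⊑-◁ p v◁w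
  ... | inj₁ u⊑w = inj₁ (refl ∷ u⊑w)
  ... | inj₂ u◁w = inj₂ (there u◁w)

  _≤ˡ_ : Word → Word → Set
  u ≤ˡ v = u ⊑ v ⊎ u ◁ v

  _<ˡ_ : Word → Word → Set
  u <ˡ v = u ≤ˡ v × ¬ v ⊑ u

  ≤ˡ-trans : ∀ {u v w} → u ≤ˡ v → v ≤ˡ w → u ≤ˡ w
  ≤ˡ-trans (inj₁ u⊑v) (inj₁ v⊑w) = inj₁ (⊑-trans u⊑v v⊑w)
  ≤ˡ-trans (inj₁ u⊑v) (inj₂ v◁w) = ⊑-◁ u⊑v v◁w
  ≤ˡ-trans (inj₂ u◁v) (inj₁ v⊑w) = inj₂ (◁-⊑ʳ u◁v v⊑w)
  ≤ˡ-trans (inj₂ u◁v) (inj₂ v◁w) = inj₂ (◁-trans u◁v v◁w)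

  ◁-≤ˡ : ∀ {u v w} → u ◁ v → v ≤ˡ w → u ◁ w
  ◁-≤ˡ u◁v (inj₁ v⊑w) = ◁-⊑ʳ u◁v v⊑w
  ◁-≤ˡ u◁v (inj₂ v◁w) = ◁-trans u◁v v◁w

  ◁⇒<ˡ : ∀ {u v} → u ◁ v → u <ˡ v
  ◁⇒<ˡ u◁v = inj₂ u◁v , ◁⇒⋣ u◁v

  <ˡ⇒≱ˡ : ∀ {u v} → u <ˡ v → ¬ v ≤ˡ u
  <ˡ⇒≱ˡ (_ , v⋢u)          (inj₁ v⊑u) = v⋢u v⊑u
  <ˡ⇒≱ˡ (inj₁ u⊑v , _)     (inj₂ v◁u) = ◁⇒⋣ v◁u u⊑v
  <ˡ⇒≱ˡ (inj₂ u◁v , _)     (inj₂ v◁u) = ◁-asym u◁v v◁u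

  <ˡ-≤ˡ-trans : ∀ {u v w} → u <ˡ v → v ≤ˡ w → u <ˡ w
  <ˡ-≤ˡ-trans u<v@(u≤v , _) v≤w =
    ≤ˡ-trans u≤v v≤w , λ w⊑u → <ˡ⇒≱ˡ u<v (≤ˡ-trans v≤w (inj₁ w⊑u))

  <ˡ-trans : ∀ {u v w} → u <ˡ v → v <ˡ w → u <ˡ w
  <ˡ-trans u<v (v≤w , _) = <ˡ-≤ˡ-trans u<v v≤w

  <ˡ-++⁺ : ∀ x {u v} → u <ˡ v → x ++ u <ˡ x ++ v
  <ˡ-++⁺ x (inj₁ u⊑v , v⋢u) = inj₁ (⊑-++⁺ x u⊑v) , v⋢u ∘′ ⊑-++⁻ x
  <ˡ-++⁺ x (inj₂ u◁v , v⋢u) = inj₂ (◁-++⁺ x u◁v) , v⋢u ∘′ ⊑-++⁻ x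

  []<ˡ : ∀ {v} → v ≢ [] → [] <ˡ v
  []<ˡ {[]}    v≢[] = ⊥-elim (v≢[] refl)
  []<ˡ {_ ∷ _} _    = inj₁ [] , λ ()

  ⊑-<ˡ : ∀ {u v w} → u ⊑ v → v <ˡ w → u ≤ˡ w
  ⊑-<ˡ u⊑v (v≤w , _) = ≤ˡ-trans (inj₁ u⊑v) v≤w

  ⪯⇒≤ˡ : ∀ {u v} → u ⪯ v → u ≤ˡ v
  ⪯⇒≤ˡ (inj₁ (w , refl)) = inj₁ (⊑-++ _ w)
  ⪯⇒≤ˡ (inj₂ (x , _ , _ , _ , _ , a<b , refl , refl)) = inj₂ (◁-++⁺ x (here a<b))

  ≺⇒<ˡ : ∀ {u v} → u ≺ v → u <ˡ v
  ≺⇒<ˡ (u⪯v , u≢v) with ⪯⇒≤ˡ u⪯v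
  ... | inj₁ u⊑v = inj₁ u⊑v , u≢v ∘′ ⊑-antisym u⊑v
  ... | inj₂ u◁v = ◁⇒<ˡ u◁v


module Factorisation {A : Set} (_<ₐ_ : Rel A 0ℓ) (sto : IsStrictTotalOrder _≡_ _<ₐ_) where

  open WordOrder _<ₐ_ sto public
  open Lyndon _<ₐ_

  lyndon-≤ˡ-suffix : ∀ {f} a {u} → IsLyndon f → f ≡ a ++ u → u ≢ [] → f ≤ˡ u
  lyndon-≤ˡ-suffix []      _  refl _    = inj₁ ⊑-refl
  lyndon-≤ˡ-suffix (c ∷ a) Lf f≡au u≢[] = proj₁ (≺⇒<ˡ (proj₂ Lf (c ∷ a) _ f≡au (λ ()) u≢[]))

  -- When g = f y, the step f^(e+1) S′ = f (f^e S′) < f y uses g < y, as g is Lyndon.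
  ^-++-<ˡ : ∀ {f g S′} → IsLyndon g → f ≢ [] → f <ˡ g → S′ <ˡ f → ∀ e → f ^ e ++ S′ <ˡ g
  ^-++-<ˡ _ _ f<g S′<f zero = <ˡ-trans S′<f f<g
  ^-++-<ˡ {f} {g} {S′} _ _ (inj₂ f◁g , _) _ (suc e) =
    subst (_<ˡ g) (sym (++-assoc f (f ^ e) S′)) (◁⇒<ˡ (◁-⊑ˡ f◁g (⊑-++ f (f ^ e ++ S′))))
  ^-++-<ˡ {f} {g} {S′} Lg f≢[] f<g@(inj₁ f⊑g , g⋢f) S′<f (suc e) with ⊑⇒IsPrefix f⊑g
  ... | [] , g≡f++[] = ⊥-elim (g⋢f (subst (_⊑ f) (sym (trans g≡f++[] (++-identityʳ f))) ⊑-refl))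
  ... | c ∷ y , g≡fy =
    subst₂ _<ˡ_ (sym (++-assoc f (f ^ e) S′)) (sym g≡fy)
      (<ˡ-++⁺ f (<ˡ-trans (^-++-<ˡ Lg f≢[] f<g S′<f e) g<y))
    where
    g<y : g <ˡ c ∷ y
    g<y = ≺⇒<ˡ (proj₂ Lg f (c ∷ y) g≡fy f≢[] (λ ()))

  concatRuns : List (Word × ℕ) → Word
  concatRuns fs = concat (map Run fs)

  HeadBelow : Word → List (Word × ℕ) → Set
  HeadBelow g []            = ⊤
  HeadBelow g ((f , _) ∷ _) = f <ˡ g

  decreasing-tail : ∀ {x l} → Decreasing (x ∷ l) → Decreasing l
  decreasing-tail dec-[ _ ]  = dec-[]
  decreasing-tail (dec-∷ _ d) = d

  concatRuns-<ˡ : ∀ {g} fs → IsLyndon g → HeadBelow g fs → AllLyndonPos fs →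
                  Decreasing (map proj₁ fs) → concatRuns fs <ˡ g
  concatRuns-<ˡ []             Lg _   _                 _   = []<ˡ (proj₁ Lg)
  concatRuns-<ˡ ((f , e) ∷ fs) Lg f<g (Lf , _ , lyndons) dec =
    ^-++-<ˡ Lg (proj₁ Lf) f<g
      (concatRuns-<ˡ fs Lf (head-below fs dec) lyndons (decreasing-tail dec)) e
    where
    head-below : ∀ fs → Decreasing (f ∷ map proj₁ fs) → HeadBelow f fs
    head-below []      _              = tt
    head-below (_ ∷ _) (dec-∷ f′≺f _) = ≺⇒<ˡ f′≺f

  AllLyndonPos-drop : ∀ i fs → AllLyndonPos fs → AllLyndonPos (drop i fs)
  AllLyndonPos-drop zero    fs       all           = all
  AllLyndonPos-drop (suc i) []       all           = all
  AllLyndonPos-drop (suc i) (_ ∷ fs) (_ , _ , all) = AllLyndonPos-drop i fs all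

  Decreasing-drop : ∀ i (fs : List (Word × ℕ)) →
                    Decreasing (map proj₁ fs) → Decreasing (map proj₁ (drop i fs))
  Decreasing-drop zero    fs       dec = dec
  Decreasing-drop (suc i) []       dec = dec
  Decreasing-drop (suc i) (_ ∷ fs) dec = Decreasing-drop i fs (decreasing-tail dec)

  HeadBelow-drop : ∀ {g} i fs → (i < length fs → fAt fs i <ˡ g) → HeadBelow g (drop i fs)
  HeadBelow-drop zero    []       _      = tt
  HeadBelow-drop (suc i) []       _      = tt
  HeadBelow-drop zero    (_ ∷ _)  fi<g = fi<g (s≤s z≤n)
  HeadBelow-drop (suc i) (_ ∷ fs) fi<g = HeadBelow-drop i fs (fi<g ∘′ s≤s)

  lyndon-fAt : ∀ fs {j} → AllLyndonPos fs → j < length fs → IsLyndon (fAt fs j)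
  lyndon-fAt (_ ∷ _)  {zero}  (Lf , _ , _)   _         = Lf
  lyndon-fAt (_ ∷ fs) {suc j} (_ , _ , all) (s≤s j<m) = lyndon-fAt fs all j<m

  fAt-<ˡ : ∀ fs {j k} → Decreasing (map proj₁ fs) → j < k → k < length fs → fAt fs k <ˡ fAt fs j
  fAt-<ˡ (_ ∷ _ ∷ _)  {zero}  {suc zero}    (dec-∷ f₁≺f₀ _) _ _ = ≺⇒<ˡ f₁≺f₀
  fAt-<ˡ (_ ∷ f₁ ∷ fs) {zero} {suc (suc k)} (dec-∷ f₁≺f₀ dec) _ (s≤s k<m) =
    <ˡ-trans (fAt-<ˡ (f₁ ∷ fs) dec (s≤s z≤n) k<m) (≺⇒<ˡ f₁≺f₀)
  fAt-<ˡ (_ ∷ fs) {suc j} {suc k} dec (s≤s j<k) (s≤s k<m) = fAt-<ˡ fs (decreasing-tail dec) j<k k<m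

  concatRuns-drop-<ˡ : ∀ fs {i k} → AllLyndonPos fs → Decreasing (map proj₁ fs) →
                       k < i → i ≤ length fs → concatRuns (drop i fs) <ˡ fAt fs k
  concatRuns-drop-<ˡ fs {i} {k} lyndons dec k<i i≤m =
    concatRuns-<ˡ (drop i fs) (lyndon-fAt fs lyndons (<-≤-trans k<i i≤m))
      (HeadBelow-drop i fs (fAt-<ˡ fs dec k<i))
      (AllLyndonPos-drop i fs lyndons) (Decreasing-drop i fs dec)

  concatRuns-take-drop : ∀ j fs → concatRuns fs ≡ concatRuns (take j fs) ++ concatRuns (drop j fs)
  concatRuns-take-drop j fs = begin
    concatRuns fs                                          ≡⟨ cong concatRuns (take++drop≡id j fs) ⟨
    concat (map Run (take j fs ++ drop j fs))              ≡⟨ cong concat (map-++ Run (take j fs) (drop j fs)) ⟩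
    concat (map Run (take j fs) ++ map Run (drop j fs))    ≡⟨ concat-++ (map Run (take j fs)) _ ⟨
    concatRuns (take j fs) ++ concatRuns (drop j fs)       ∎
    where open ≡-Reasoning

  runStart-suc : ∀ f e fs i → runStart ((f , e) ∷ fs) (suc i) ≡ length (f ^ e) + runStart fs i
  runStart-suc f e fs i = length-++ (f ^ e)

  runStart-mono : ∀ fs {j k} → j ≤ k → runStart fs j ≤ runStart fs k
  runStart-mono fs             {zero}           _         = z≤n
  runStart-mono []             {suc j} {suc k}  _         = z≤n
  runStart-mono ((f , e) ∷ fs) {suc j} {suc k} (s≤s j≤k) =
    subst₂ _≤_ (sym (runStart-suc f e fs j)) (sym (runStart-suc f e fs k))
      (+-monoʳ-≤ (length (f ^ e)) (runStart-mono fs j≤k))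

  fAt-⊑-concatRuns-drop : ∀ fs {j} → AllLyndonPos fs → j < length fs →
                          fAt fs j ⊑ concatRuns (drop j fs)
  fAt-⊑-concatRuns-drop ((f , suc e) ∷ fs) {zero}  _              _         =
    ⊑-trans (⊑-++ f (f ^ e)) (⊑-++ (f ^ suc e) (concatRuns fs))
  fAt-⊑-concatRuns-drop (_ ∷ fs)           {suc j} (_ , _ , all) (s≤s j<m) =
    fAt-⊑-concatRuns-drop fs all j<m

  ++-split : ∀ (x t y r : Word) → x ++ t ≡ y ++ r →
             (∃ λ u → u ≢ [] × y ≡ x ++ u × t ≡ u ++ r) ⊎ (∃ λ x′ → x ≡ y ++ x′ × r ≡ x′ ++ t)
  ++-split []      t []      r eq = inj₂ ([] , refl , sym eq)
  ++-split []      t (c ∷ y) r eq = inj₁ (c ∷ y , (λ ()) , refl , eq)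
  ++-split (c ∷ x) t []      r eq = inj₂ (c ∷ x , refl , sym eq)
  ++-split (c ∷ x) t (_ ∷ y) r eq with ∷-injective eq
  ... | refl , eq′ with ++-split x t y r eq′
  ... | inj₁ (u , u≢[] , y≡xu , t≡ur)  = inj₁ (u , u≢[] , cong (c ∷_) y≡xu , t≡ur)
  ... | inj₂ (x′ , x≡yx′ , r≡x′t)       = inj₂ (x′ , cong (c ∷_) x≡yx′ , r≡x′t)

  BeginsInside : Word → Word → Set
  BeginsInside f t = ∃ λ a → ∃ λ u → ∃ λ z → f ≡ a ++ u × u ≢ [] × t ≡ u ++ z

  BeginsInside-++ : ∀ {f t} r → BeginsInside f t → BeginsInside f (t ++ r)
  BeginsInside-++ r (a , u , z , f≡au , u≢[] , refl) = a , u , z ++ r , f≡au , u≢[] , ++-assoc u z r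

  ^-BeginsInside : ∀ f e x {t} → f ^ e ≡ x ++ t → t ≢ [] → BeginsInside f t
  ^-BeginsInside f zero    []  refl t≢[] = ⊥-elim (t≢[] refl)
  ^-BeginsInside f (suc e) x {t} eq t≢[] with ++-split x t f (f ^ e) (sym eq)
  ... | inj₁ (u , u≢[] , f≡xu , t≡u++fᵉ) = x , u , f ^ e , f≡xu , u≢[] , t≡u++fᵉ
  ... | inj₂ (x′ , _ , fᵉ≡x′t)           = ^-BeginsInside f e x′ fᵉ≡x′t t≢[]

  position-in-run : ∀ fs i x {t} → concatRuns fs ≡ x ++ t → length x < runStart fs i →
    ∃ λ j → j < i × runStart fs j ≤ length x × BeginsInside (fAt fs j) t
  position-in-run (_ ∷ _)        zero    x _ ()
  position-in-run ((f , e) ∷ fs) (suc i) x {t} eq x<start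
    with ++-split x t (f ^ e) (concatRuns fs) (sym eq)
  ... | inj₁ (u , u≢[] , fᵉ≡xu , t≡ur) =
    zero , s≤s z≤n , z≤n ,
    subst (BeginsInside f) (sym t≡ur)
      (BeginsInside-++ (concatRuns fs) (^-BeginsInside f e x fᵉ≡xu u≢[]))
  ... | inj₂ (x′ , x≡fᵉx′ , r≡x′t) = shift (position-in-run fs i x′ r≡x′t x′<start)
    where
    |x| : length x ≡ length (f ^ e) + length x′
    |x| = trans (cong length x≡fᵉx′) (length-++ (f ^ e))

    x′<start : length x′ < runStart fs i
    x′<start = +-cancelˡ-< (length (f ^ e)) _ _ (subst₂ _<_ |x| (runStart-suc f e fs i) x<start)

    shift : (∃ λ j → j < i × runStart fs j ≤ length x′ × BeginsInside (fAt fs j) t) →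
            ∃ λ j → j < suc i × runStart ((f , e) ∷ fs) j ≤ length x ×
                    BeginsInside (fAt ((f , e) ∷ fs) j) t
    shift (j , j<i , start≤x′ , inside) =
      suc j , s≤s j<i ,
      subst₂ _≤_ (sym (runStart-suc f e fs j)) (sym |x|) (+-monoʳ-≤ (length (f ^ e)) start≤x′) , inside

  ⊑-squeeze : ∀ {w z f u} → w ⊑ z → z <ˡ f → f ≤ˡ u → w ⊑ u ⊎ u ⊑ w → w ⊑ f
  ⊑-squeeze w⊑z z<f f≤u w~u with ⊑-<ˡ w⊑z z<f
  ... | inj₁ w⊑f = w⊑f
  ... | inj₂ w◁f with w~u
  ...   | inj₁ w⊑u = ⊥-elim (◁⇒⋢ (◁-≤ˡ w◁f f≤u) w⊑u)
  ...   | inj₂ u⊑w = ⊥-elim (<ˡ⇒≱ˡ z<f (≤ˡ-trans f≤u (inj₁ (⊑-trans u⊑w w⊑z))))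


module BlockOccurrences {A : Set} (_<ₐ_ : Rel A 0ℓ) (sto : IsStrictTotalOrder _≡_ _<ₐ_)
  (s : List A) (fs : List (List A × ℕ)) (fact : Lyndon.IsLyndonFactorization _<ₐ_ s fs)
  (i d : ℕ) (i≤m : i ≤ length fs) where

  open Factorisation _<ₐ_ sto public
  open Lyndon _<ₐ_

  private
    concat≡s : concatRuns fs ≡ s
    concat≡s = proj₁ fact

    lyndons : AllLyndonPos fs
    lyndons = proj₁ (proj₂ fact)

    decreasing : Decreasing (map proj₁ fs)
    decreasing = proj₂ (proj₂ fact)

  w : Word
  w = block fs i d

  w⊑suffix : w ⊑ concatRuns (drop i fs)
  w⊑suffix = IsPrefix⇒⊑ (_ , concatRuns-take-drop d (drop i fs))

  suffix-<ˡ-fAt : ∀ {k} → k < i → concatRuns (drop i fs) <ˡ fAt fs k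
  suffix-<ˡ-fAt k<i = concatRuns-drop-<ˡ fs lyndons decreasing k<i i≤m

  early-occurrence-⊑-fAt : ∀ {p} → OccursAt w s p → p < runStart fs i →
                           ∃ λ j → j < i × runStart fs j ≤ p × w ⊑ fAt fs j
  early-occurrence-⊑-fAt (x , y , s≡xwy , refl) x<start
    with position-in-run fs i x (trans concat≡s s≡xwy) x<start
  ... | j , j<i , start≤x , a , u , z , fⱼ≡au , u≢[] , wy≡uz =
    j , j<i , start≤x ,
    ⊑-squeeze w⊑suffix (suffix-<ˡ-fAt j<i)
      (lyndon-≤ˡ-suffix a (lyndon-fAt fs lyndons (<-≤-trans j<i i≤m)) fⱼ≡au u≢[])
      (⊑-comparable (⊑-++ w y) (IsPrefix⇒⊑ (z , wy≡uz)))

  occurs-at-runStart : ∀ {j} → j < length fs → w ⊑ fAt fs j → OccursAt w s (runStart fs j)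
  occurs-at-runStart {j} j<m w⊑fⱼ
    with ⊑⇒IsPrefix (⊑-trans w⊑fⱼ (fAt-⊑-concatRuns-drop fs lyndons j<m))
  ... | y , suffix≡wy = concatRuns (take j fs) , y , s≡ , refl
    where
    open ≡-Reasoning
    s≡ : s ≡ concatRuns (take j fs) ++ w ++ y
    s≡ = begin
      s                                                  ≡⟨ concat≡s ⟨
      concatRuns fs                                      ≡⟨ concatRuns-take-drop j fs ⟩
      concatRuns (take j fs) ++ concatRuns (drop j fs)   ≡⟨ cong (concatRuns (take j fs) ++_) suffix≡wy ⟩
      concatRuns (take j fs) ++ w ++ y                   ∎

  occurrence-leftmost : ∀ {j} → j < i → (∀ {k} → k < j → ¬ w ⊑ fAt fs k) →
                        ∀ p → OccursAt w s p → runStart fs j ≤ p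
  occurrence-leftmost {j} j<i minimal p occ with p <? runStart fs i
  ... | yes p<start =
    let j′ , _ , start′≤p , w⊑fⱼ′ = early-occurrence-⊑-fAt occ p<start
    in ≤-trans (runStart-mono fs (≮⇒≥ λ j′<j → minimal j′<j w⊑fⱼ′)) start′≤p
  ... | no p≮start = ≤-trans (runStart-mono fs (<⇒≤ j<i)) (≮⇒≥ p≮start)

  ⊑-fAt-between : ∀ {j k} → w ⊑ fAt fs j → j < k → k < i → w ⊑ fAt fs k
  ⊑-fAt-between w⊑fⱼ j<k k<i =
    ⊑-squeeze w⊑suffix (suffix-<ˡ-fAt k<i)
      (proj₁ (fAt-<ˡ fs decreasing j<k (<-≤-trans k<i i≤m))) (inj₁ w⊑fⱼ)

lemma3 : {A : Set} (_<ₐ_ : Rel A 0ℓ) → IsStrictTotalOrder _≡_ _<ₐ_ →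
    let open Lyndon _<ₐ_ in
    (s : List A) (fs : List (List A × ℕ)) → IsLyndonFactorization s fs →
    (i d : ℕ) → 1 ≤ d → i + d ≤ length fs →
    (∃ λ p → (p < runStart fs i) × OccursAt (block fs i d) s p) →
    ∃ λ j → (j < i)
    × IsPrefix (block fs i d) (fAt fs j)
    × OccursAt (block fs i d) s (runStart fs j)
    × (∀ p → OccursAt (block fs i d) s p → runStart fs j ≤ p)
    × (∀ k → j < k → k < i → IsPrefix (block fs i d) (fAt fs k))
lemma3 _<ₐ_ sto s fs fact i d _ i+d≤m (_ , p<start , occ) =
  let j₀ , j₀<i , _ , w⊑fⱼ₀ = early-occurrence-⊑-fAt occ p<start
      j , w⊑fⱼ , minimal    = least-witness (λ k → w ⊑? fAt fs k) w⊑fⱼ₀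
      j<i                   = ≤-<-trans (≮⇒≥ λ j₀<j → minimal j₀<j w⊑fⱼ₀) j₀<i
  in j , j<i , ⊑⇒IsPrefix w⊑fⱼ , occurs-at-runStart (<-≤-trans j<i i≤m) w⊑fⱼ ,
     occurrence-leftmost j<i minimal ,
     λ k j<k k<i → ⊑⇒IsPrefix (⊑-fAt-between w⊑fⱼ j<k k<i)
  where
  i≤m : i ≤ length fs
  i≤m = ≤-trans (m≤m+n i d) i+d≤m

  open Lyndon _<ₐ_ using (fAt)
  open BlockOccurrences _<ₐ_ sto s fs fact i d i≤m
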